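{- Let $\Gamma^1,\Gamma^2$ be lower Eulerian posets and let $\Gamma_B=\Gamma^1\cap\Gamma^2$ carry the same induced order from both, such that $(\Gamma^1,\Gamma_B)$ and $(\Gamma^2,\Gamma_B)$ are posets with boundary. Then $$h(\Gamma^1\sharp_{\Gamma_B}\Gamma^2;t)=h(\Gamma^1;t)+h(\Gamma^2;t)+(t-1)\,h(\Gamma_B;t).$$
   Context: A finite poset is ranked if it has a rank function $\rho$ such that every maximal chain in each interval $[x,y]$ has length $\rho(y)-\rho(x)=:\rho(x,y)$; it is locally Eulerian if moreover every interval $[x,y]$ with $x\ne y$ has equally many elements of even and odd rank; lower Eulerian if in addition it has a minimum $\hat 0$ (with $\rho(\hat0)=0$); Eulerian if it also has a maximum $\hat 1$. The rank $\mathrm{rk}$ of a poset is the length of its longest chain. For an Eulerian poset $B$ of rank $r$, $g(B;t)=1$ if $r=0$, and otherwise $g(B;t)$ is the unique polynomial of degree $<r/2$ with $t^rg(B;t^{ -1})=\sum_{x\in B}g([\hat 0,x];t)(t-1)^{r-\rho(\hat0,x)}$. For a lower Eulerian poset $\Gamma$ of rank $r$, the $h$-polynomial is defined by $t^rh(\Gamma;t^{ -1})=\sum_{x\in\Gamma}g([\hat0,x];t)(t-1)^{r-\rho(\hat0,x)}$. A poset with boundary is a pair $(\Gamma,\Gamma_B)$ where $\Gamma_B\subseteq\Gamma$ is a lower set (closed under taking smaller elements) with $\mathrm{rk}(\Gamma_B)=\mathrm{rk}(\Gamma)-1$. The agglutination $\Gamma^1\sharp_{\Gamma_B}\Gamma^2$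 is the poset on $\Gamma^1\cup\Gamma^2$ inducing the given orders on $\Gamma^1$ and on $\Gamma^2$, in which elements of $\Gamma^1\setminus\Gamma_B$ and $\Gamma^2\setminus\Gamma_B$ are incomparable. -}

module Defs where

open import Data.Bool using (Bool; true; false; T; not; _∧_; if_then_else_)
open import Data.Nat as ℕ using (ℕ; zero; suc; _∸_; _<ᵇ_; _≤ᵇ_; _≡ᵇ_)
open import Data.Integer as ℤ using (ℤ; +_; -[1+_]; 0ℤ; 1ℤ)
open import Data.Fin using (Fin; _↑ˡ_; _↑ʳ_; splitAt; _≟_)
open import Data.List using (List; []; _∷_; length; allFin; foldr; map)
open import Data.Nat.ListAction using (sum)
open import Data.List.Relation.Unary.All using (All)
open import Data.List.Relation.Unary.Linked using (Linked)
open import Data.List.Membership.Propositional using (_∈_)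
open import Data.Product using (Σ; _×_; _,_)
open import Data.Sum using (_⊎_; inj₁; inj₂)
open import Data.Maybe using (Maybe; just; nothing)
open import Relation.Nullary using (does; ¬_)
open import Relation.Binary.PropositionalEquality using (_≡_; _≢_)
open import Relation.Binary.Structures using (IsPartialOrder)

record FinPoset : Set where
  constructor mkPoset
  field
    size : ℕ
    le   : Fin size → Fin size → Bool

open FinPoset public

module _ (P : FinPoset) where

  _≤P_ : Fin (size P) → Fin (size P) → Set
  x ≤P y = T (le P x y)

  _<P_ : Fin (size P) → Fin (size P) → Set
  x <P y = (x ≤P y) × (x ≢ y)

  ltᵇ : Fin (size P) → Fin (size P) → Bool
  ltᵇ x y = le P x y ∧ not (does (x ≟ y))

  IsPoset : Set
  IsPoset = IsPartialOrder _≡_ _≤P_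

  IsChain : List (Fin (size P)) → Set
  IsChain c = Linked _<P_ c

  InInterval : Fin (size P) → Fin (size P) → Fin (size P) → Set
  InInterval x y z = (x ≤P z) × (z ≤P y)

  Comparable : Fin (size P) → Fin (size P) → Set
  Comparable z w = (z ≤P w) ⊎ (w ≤P z)

  IsMaxChainIn : Fin (size P) → Fin (size P) → List (Fin (size P)) → Set
  IsMaxChainIn x y c =
    IsChain c × All (InInterval x y) c ×
    (∀ z → InInterval x y z → All (Comparable z) c → z ∈ c)

  -- ρ is a rank function: every maximal chain of [x,y] has length
  -- (= number of elements - 1) equal to ρ(y) - ρ(x).
  IsRankFunction : (Fin (size P) → ℕ) → Set
  IsRankFunction ρ = ∀ x y c → x ≤P y → IsMaxChainIn x y c →
                     suc (ρ y) ≡ ρ x ℕ.+ length c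

  countᵇ : (Fin (size P) → Bool) → ℕ
  countᵇ p = sum (map (λ z → if p z then 1 else 0) (allFin (size P)))

  LocallyEulerian : (Fin (size P) → ℕ) → Set
  LocallyEulerian ρ = ∀ x y → x ≤P y → x ≢ y →
    countᵇ (λ z → le P x z ∧ le P z y ∧ evenᵇ (ρ z))
      ≡ countᵇ (λ z → le P x z ∧ le P z y ∧ not (evenᵇ (ρ z)))
    where
    evenᵇ : ℕ → Bool
    evenᵇ zero = true
    evenᵇ (suc n) = not (evenᵇ n)

  IsLowerEulerian : (Fin (size P) → ℕ) → Set
  IsLowerEulerian ρ = IsPoset × IsRankFunction ρ × LocallyEulerian ρ ×
    Σ (Fin (size P)) (λ z → (∀ x → z ≤P x) × ρ z ≡ 0)

  IsRk : ℤ → Set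
  IsRk r = Σ (List (Fin (size P))) (λ c → IsChain c × r ≡ + length c ℤ.- 1ℤ)
         × (∀ c → IsChain c → (+ length c ℤ.- 1ℤ) ℤ.≤ r)

-- Polynomials with integer coefficients as coefficient sequences.

Poly : Set
Poly = ℕ → ℤ

oneP : Poly
oneP zero = 1ℤ
oneP (suc _) = 0ℤ

zeroP : Poly
zeroP _ = 0ℤ

_+P_ : Poly → Poly → Poly
(p +P q) n = p n ℤ.+ q n

negP : Poly → Poly
negP p n = ℤ.- p n

-- multiplication by (t - 1)
mulT1 : Poly → Poly
mulT1 p zero = ℤ.- p zero
mulT1 p (suc n) = p n ℤ.- p (suc n)

powT1 : ℕ → Poly → Poly
powT1 zero p = p
powT1 (suc m) p = mulT1 (powT1 m p)

sumP : List Poly → Poly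
sumP = foldr _+P_ zeroP

truncHalf : ℕ → Poly → Poly
truncHalf r p n = if (2 ℕ.* n) <ᵇ r then p n else 0ℤ

-- With ρ(0̂) = 0, ρ(0̂,x) = ρ(x) and the defining identity
--   t^r g(t^{-1}) = Σ_{z ≤ x} g([0̂,z];t) (t-1)^{r - ρ(z)},  r = ρ(x),
-- with deg g < r/2 forces g = - (degree < r/2 part of Σ_{z < x} ...).
-- (fuel k bounds ρ x; the actual recursion is on ρ).

module _ (P : FinPoset) (ρ : Fin (size P) → ℕ) where

  gFuel : ℕ → Fin (size P) → Poly
  gFuel zero x = oneP
  gFuel (suc k) x = if ρ x ≡ᵇ 0 then oneP else
    negP (truncHalf (ρ x)
      (sumP (map (λ z → if ltᵇ P z x then powT1 (ρ x ∸ ρ z) (gFuel k z) else zeroP)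
                 (allFin (size P)))))

  gLower : Fin (size P) → Poly
  gLower x = gFuel (ρ x) x

  -- h(Γ;t) for Γ of rank r, defined by t^r h(t^{-1}) = S(t),
  -- S(t) = Σ_x g([0̂,x];t) (t-1)^{r - ρ(x)}; i.e. h_i = S_{r-i}.
  hPoly : ℤ → Poly
  hPoly -[1+ _ ] i = 0ℤ
  hPoly (+ r) i = if i ≤ᵇ r then S (r ∸ i) else 0ℤ
    where
    S : Poly
    S = sumP (map (λ x → powT1 (r ∸ ρ x) (gLower x)) (allFin (size P)))

-- The configuration: Γ_B = Fin b, Γ¹ on Fin (b + a₁), Γ² on Fin (b + a₂),
-- where Γ_B sits in Γⁱ as the first b elements (i ↑ˡ aᵢ); Γ¹ ∩ Γ² = Γ_B.

IsLowerSetB : (b a : ℕ) → (Fin (b ℕ.+ a) → Fin (b ℕ.+ a) → Bool) → Set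
IsLowerSetB b a le' = ∀ x (j : Fin b) → T (le' x (j ↑ˡ a)) → Σ (Fin b) (λ i → x ≡ i ↑ˡ a)

subB : (b a : ℕ) → (Fin (b ℕ.+ a) → Fin (b ℕ.+ a) → Bool) → FinPoset
subB b a le' = mkPoset b (λ i j → le' (i ↑ˡ a) (j ↑ˡ a))

module Agglutination (b a₁ a₂ : ℕ)
  (le₁ : Fin (b ℕ.+ a₁) → Fin (b ℕ.+ a₁) → Bool)
  (le₂ : Fin (b ℕ.+ a₂) → Fin (b ℕ.+ a₂) → Bool) where

  -- carrier of the agglutination: Γ_B ⊔ (Γ¹∖Γ_B) ⊔ (Γ²∖Γ_B)
  side : Fin (b ℕ.+ (a₁ ℕ.+ a₂)) → Fin b ⊎ (Fin a₁ ⊎ Fin a₂)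
  side x with splitAt b x
  ... | inj₁ i = inj₁ i
  ... | inj₂ k with splitAt a₁ k
  ...   | inj₁ u = inj₂ (inj₁ u)
  ...   | inj₂ v = inj₂ (inj₂ v)

  in₁ : Fin b ⊎ (Fin a₁ ⊎ Fin a₂) → Maybe (Fin (b ℕ.+ a₁))
  in₁ (inj₁ i) = just (i ↑ˡ a₁)
  in₁ (inj₂ (inj₁ u)) = just (b ↑ʳ u)
  in₁ (inj₂ (inj₂ v)) = nothing

  in₂ : Fin b ⊎ (Fin a₁ ⊎ Fin a₂) → Maybe (Fin (b ℕ.+ a₂))
  in₂ (inj₁ i) = just (i ↑ˡ a₂)
  in₂ (inj₂ (inj₁ u)) = nothing
  in₂ (inj₂ (inj₂ v)) = just (b ↑ʳ v)

  leAgg : Fin (b ℕ.+ (a₁ ℕ.+ a₂)) → Fin (b ℕ.+ (a₁ ℕ.+ a₂)) → Bool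
  leAgg x y with in₁ (side x) | in₁ (side y)
  ... | just p | just q = le₁ p q
  ... | _ | _ with in₂ (side x) | in₂ (side y)
  ...   | just p | just q = le₂ p q
  ...   | _ | _ = false

  agg : FinPoset
  agg = mkPoset (b ℕ.+ (a₁ ℕ.+ a₂)) leAgg

  ρAgg : (Fin (b ℕ.+ a₁) → ℕ) → (Fin (b ℕ.+ a₂) → ℕ) → Fin (b ℕ.+ (a₁ ℕ.+ a₂)) → ℕ
  ρAgg ρ₁ ρ₂ x with side x
  ... | inj₁ i = ρ₁ (i ↑ˡ a₁)
  ... | inj₂ (inj₁ u) = ρ₁ (b ↑ʳ u)
  ... | inj₂ (inj₂ v) = ρ₂ (b ↑ʳ v)

module Submission where

-- Γ_B, Γ¹ and Γ² are down-closed in the agglutination Γ, and g([0̂,x]) only depends on the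
-- interval below x, so every summand g([0̂,x]) (t-1)^(r-ρ(x)) of t^r h(t⁻¹) can be computed in
-- whichever of the pieces contains x. Ranks on Γ_B computed in Γ¹ and in Γ² agree, being both the
-- length of a maximal chain of Γ_B from the common minimum, and rk Γ = rk Γ¹ = rk Γ² = r, since a
-- chain of Γ lies in Γ¹ or in Γ². Hence inclusion-exclusion gives S_Γ = S_Γ¹ + S_Γ² - S_ΓB for
-- these sums at rank r. As rk Γ_B = r - 1, the Γ_B term is (t-1) times the sum defining h(Γ_B),
-- and reversing the coefficients turns it into -(t-1) h(Γ_B).

open import Defs
open import Data.Bool using (Bool; true; false; T; not; _∧_; if_then_else_)
open import Data.Bool.Properties using (T?)
open import Data.Empty using (⊥; ⊥-elim)
open import Data.Fin using (Fin; zero; suc; _↑ˡ_; _↑ʳ_; splitAt; join)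
import Data.Fin as Fin
open import Data.Fin.Induction using (po-wellFounded; po-noetherian)
open import Data.Fin.Properties
  using (any?; ↑ˡ-injective; splitAt-↑ˡ; splitAt-↑ʳ; splitAt⁻¹-↑ˡ; splitAt⁻¹-↑ʳ; splitAt-join; join-splitAt)
open import Data.Integer as ℤ using (ℤ; +_; -[1+_]; 0ℤ; 1ℤ; _+_; _-_; -_; -≤-)
import Data.Integer.Properties as ℤ
open import Data.Integer.Tactic.RingSolver using (solve-∀)
open import Data.List using (List; []; _∷_; map; allFin; tabulate; length)
open import Data.List.Membership.Propositional using (_∈_)
open import Data.List.Membership.Propositional.Properties using (∈-map⁺)
open import Data.List.Properties using (map-tabulate; length-map)
open import Data.List.Relation.Unary.All as All using (All; []; _∷_)
import Data.List.Relation.Unary.All.Properties as All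
open import Data.List.Relation.Unary.Any using (here; there)
open import Data.List.Relation.Unary.Linked as Linked using (Linked; []; [-]; _∷_)
import Data.List.Relation.Unary.Linked.Properties as Linked
open import Data.Maybe using (just)
open import Data.Maybe.Properties using (just-injective)
open import Data.Nat as ℕ using (ℕ; zero; suc; _∸_; _≤ᵇ_; _<ᵇ_; _≡ᵇ_; s≤s) renaming (_+_ to _+ℕ_)
import Data.Nat.Properties as ℕ
open import Data.Product using (_×_; _,_; proj₁; proj₂; ∃-syntax)
open import Data.Sum as Sum using (_⊎_; inj₁; inj₂)
open import Function using (_∘_; id; flip)
open import Induction.WellFounded using (Acc; acc)
open import Relation.Binary.Definitions using (tri<; tri≈; tri>)
open import Relation.Binary.PropositionalEquality
open import Relation.Binary.Structures using (IsPartialOrder)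
open import Relation.Nullary using (Dec; yes; no; ¬_; ¬?; _×-dec_)
open import Relation.Nullary.Decidable using (dec-true; dec-false)

-- Polynomial sums and degrees

∑ : (n : ℕ) → (Fin n → Poly) → Poly
∑ n f = sumP (tabulate f)

sumP-map-allFin : ∀ n (f : Fin n → Poly) → sumP (map f (allFin n)) ≡ ∑ n f
sumP-map-allFin n f = cong sumP (map-tabulate id f)

∑-cong : ∀ n {f g : Fin n → Poly} → (∀ z → f z ≗ g z) → ∑ n f ≗ ∑ n g
∑-cong zero    f≗g k = refl
∑-cong (suc n) f≗g k = cong₂ _+_ (f≗g zero k) (∑-cong n (f≗g ∘ suc) k)

∑-zeroP : ∀ n {f : Fin n → Poly} → (∀ z → f z ≗ zeroP) → ∑ n f ≗ zeroP
∑-zeroP zero    f≗0 k = refl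
∑-zeroP (suc n) f≗0 k = cong₂ _+_ (f≗0 zero k) (∑-zeroP n (f≗0 ∘ suc) k)

∑-↑ : ∀ m n (f : Fin (m +ℕ n) → Poly) →
      ∑ (m +ℕ n) f ≗ ∑ m (f ∘ (_↑ˡ n)) +P ∑ n (f ∘ (m ↑ʳ_))
∑-↑ zero    n f k = sym (ℤ.+-identityˡ _)
∑-↑ (suc m) n f k = begin
  f zero k + ∑ (m +ℕ n) (f ∘ suc) k
    ≡⟨ cong (λ w → f zero k + w) (∑-↑ m n (f ∘ suc) k) ⟩
  f zero k + (∑ m (f ∘ suc ∘ (_↑ˡ n)) k + ∑ n (f ∘ (suc m ↑ʳ_)) k)
    ≡⟨ ℤ.+-assoc (f zero k) _ _ ⟨
  f zero k + ∑ m (f ∘ suc ∘ (_↑ˡ n)) k + ∑ n (f ∘ (suc m ↑ʳ_)) k ∎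
  where open ≡-Reasoning

mulT1-cong : ∀ {p q} → p ≗ q → mulT1 p ≗ mulT1 q
mulT1-cong p≗q zero    = cong -_ (p≗q zero)
mulT1-cong p≗q (suc k) = cong₂ _-_ (p≗q k) (p≗q (suc k))

powT1-cong : ∀ m {p q} → p ≗ q → powT1 m p ≗ powT1 m q
powT1-cong zero    p≗q = p≗q
powT1-cong (suc m) p≗q = mulT1-cong (powT1-cong m p≗q)

mulT1-+P : ∀ p q → mulT1 (p +P q) ≗ mulT1 p +P mulT1 q
mulT1-+P p q zero    = ℤ.neg-distrib-+ (p zero) (q zero)
mulT1-+P p q (suc k) = lemma (p k) (q k) (p (suc k)) (q (suc k))
  where
  lemma : ∀ a b c d → (a + b) - (c + d) ≡ (a - c) + (b - d)
  lemma = solve-∀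

mulT1-∑ : ∀ n (f : Fin n → Poly) → mulT1 (∑ n f) ≗ ∑ n (mulT1 ∘ f)
mulT1-∑ zero    f zero    = refl
mulT1-∑ zero    f (suc k) = refl
mulT1-∑ (suc n) f k = trans (mulT1-+P (f zero) (∑ n (f ∘ suc)) k)
                            (cong (λ w → mulT1 (f zero) k + w) (mulT1-∑ n (f ∘ suc) k))

DegreeAtMost : ℕ → Poly → Set
DegreeAtMost d p = ∀ k → d ℕ.< k → p k ≡ 0ℤ

degree-mono : ∀ {d d′ p} → d ℕ.≤ d′ → DegreeAtMost d p → DegreeAtMost d′ p
degree-mono d≤d′ deg k d′<k = deg k (ℕ.≤-<-trans d≤d′ d′<k)

mulT1-degree : ∀ {d p} → DegreeAtMost d p → DegreeAtMost (suc d) (mulT1 p)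
mulT1-degree {d} {p} deg (suc k) (s≤s d<k)
  rewrite deg k d<k | deg (suc k) (ℕ.m<n⇒m<1+n d<k) = refl

powT1-degree : ∀ m {d p} → DegreeAtMost d p → DegreeAtMost (m +ℕ d) (powT1 m p)
powT1-degree zero    deg = deg
powT1-degree (suc m) deg = mulT1-degree (powT1-degree m deg)

∑-degree : ∀ n {d} {f : Fin n → Poly} → (∀ z → DegreeAtMost d (f z)) → DegreeAtMost d (∑ n f)
∑-degree zero    deg k d<k = refl
∑-degree (suc n) deg k d<k = cong₂ _+_ (deg zero k d<k) (∑-degree n (deg ∘ suc) k d<k)

oneP-degree : ∀ d → DegreeAtMost d oneP
oneP-degree d (suc k) _ = refl

truncHalf-degree : ∀ r p → DegreeAtMost r (negP (truncHalf r p))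
truncHalf-degree r p k r<k with (2 ℕ.* k) <ᵇ r in eq
... | false = refl
... | true  = ⊥-elim (ℕ.<⇒≱ (ℕ.<ᵇ⇒< _ _ (subst T (sym eq) _))
                          (ℕ.≤-trans (ℕ.<⇒≤ r<k) (ℕ.m≤m+n k (k +ℕ 0))))

gFuel-degree : ∀ P ρ k x → DegreeAtMost (ρ x) (gFuel P ρ k x)
gFuel-degree P ρ zero    x = oneP-degree _
gFuel-degree P ρ (suc k) x with ρ x ≡ᵇ 0
... | true  = oneP-degree _
... | false = truncHalf-degree _ _

-- reflect r p is t^r p(t⁻¹), with the coefficients of degree > r dropped.
reflect : ℕ → Poly → Poly
reflect r p i = if i ≤ᵇ r then p (r ∸ i) else 0ℤ

reflect-≤ : ∀ {r i} p → i ℕ.≤ r → reflect r p i ≡ p (r ∸ i)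
reflect-≤ {r} {i} p i≤r with i ≤ᵇ r in eq
... | true  = refl
... | false = ⊥-elim (subst T eq (ℕ.≤⇒≤ᵇ i≤r))

reflect-> : ∀ {r i} p → r ℕ.< i → reflect r p i ≡ 0ℤ
reflect-> {r} {i} p r<i with i ≤ᵇ r in eq
... | false = refl
... | true  = ⊥-elim (ℕ.<⇒≱ r<i (ℕ.≤ᵇ⇒≤ i r (subst T (sym eq) _)))

reflect-cong : ∀ r {p q} → p ≗ q → reflect r p ≗ reflect r q
reflect-cong r p≗q i with i ≤ᵇ r
... | true  = p≗q (r ∸ i)
... | false = refl

reflect-+P : ∀ r p q → reflect r (p +P q) ≗ reflect r p +P reflect r q
reflect-+P r p q i with i ≤ᵇ r
... | true  = refl
... | false = refl

reflect-negP : ∀ r p → reflect r (negP p) ≗ negP (reflect r p)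
reflect-negP r p i with i ≤ᵇ r
... | true  = refl
... | false = refl

reflect-mulT1 : ∀ m {p} → DegreeAtMost m p → reflect (suc m) (mulT1 p) ≗ negP (mulT1 (reflect m p))
reflect-mulT1 m {p} deg zero rewrite deg (suc m) ℕ.≤-refl =
  trans (ℤ.+-identityʳ (p m)) (sym (ℤ.neg-involutive (p m)))
reflect-mulT1 m {p} deg (suc j) with ℕ.<-cmp j m
... | tri< j<m _ _ rewrite reflect-≤ (mulT1 p) (s≤s (ℕ.<⇒≤ j<m)) | reflect-≤ p (ℕ.<⇒≤ j<m)
                          | reflect-≤ p j<m | ℕ.+-∸-assoc 1 j<m = lemma (p (m ∸ suc j)) (p (suc (m ∸ suc j)))
  where
  lemma : ∀ x y → x - y ≡ - (y - x)
  lemma = solve-∀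
... | tri≈ _ refl _ rewrite reflect-≤ (mulT1 p) (ℕ.≤-refl {suc j}) | reflect-≤ p (ℕ.≤-refl {j})
                          | reflect-> p (ℕ.n<1+n j) | ℕ.n∸n≡0 j = sym (cong -_ (ℤ.+-identityʳ (p 0)))
... | tri> _ _ m<j rewrite reflect-> (mulT1 p) (s≤s m<j) | reflect-> p m<j | reflect-> p (ℕ.m<n⇒m<1+n m<j) = refl

-- Maximal chains in finite posets

module MaximalChains (P : FinPoset) (po : IsPoset P) where
  private
    _≤_ = _≤P_ P
    _<_ = _<P_ P
    module ≤ = IsPartialOrder po

  _<?_ : ∀ x y → Dec (x < y)
  x <? y = T? (le P x y) ×-dec ¬? (x Fin.≟ y)

  _⋖_ : Fin (size P) → Fin (size P) → Set
  x ⋖ z = x < z × (∀ w → x < w → ¬ w < z)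

  cover-below : ∀ {x y} → x < y → ∃[ z ] (x ⋖ z × z ≤ y)
  cover-below {x} {y} x<y = go (po-wellFounded po y) x<y ≤.refl
    where
    go : ∀ {w} → Acc _<_ w → x < w → w ≤ y → ∃[ z ] (x ⋖ z × z ≤ y)
    go {w} (acc smaller) x<w w≤y with any? (λ v → x <? v ×-dec v <? w)
    ... | no ∄v = w , (x<w , λ v x<v v<w → ∄v (v , x<v , v<w)) , w≤y
    ... | yes (v , x<v , v<w) = go (smaller v<w) x<v (≤.trans (proj₁ v<w) w≤y)

  maximalChain : ∀ {x y} → x ≤ y → ∃[ c ] IsMaxChainIn P x y (x ∷ c)
  maximalChain {x} {y} = go (po-noetherian po x)
    where
    go : ∀ {x} → Acc (flip _<_) x → x ≤ y → ∃[ c ] IsMaxChainIn P x y (x ∷ c)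
    go {x} (acc larger) x≤y with x Fin.≟ y
    ... | yes refl = [] , [-] , (≤.refl , ≤.refl) ∷ [] ,
                     λ w (x≤w , w≤x) _ → here (≤.antisym w≤x x≤w)
    ... | no x≢y with cover-below (x≤y , x≢y)
    ... | z , (x<z , nothing-between) , z≤y with go (larger x<z) z≤y
    ... | c , linked , inside , maximal =
      z ∷ c , x<z ∷ linked ,
      (≤.refl , x≤y) ∷ All.map (λ (z≤w , w≤y) → ≤.trans (proj₁ x<z) z≤w , w≤y) inside ,
      extended
      where
      extended : ∀ w → InInterval P x y w → All (Comparable P w) (x ∷ z ∷ c) → w ∈ x ∷ z ∷ c
      extended w (_ , w≤y) (_ ∷ inj₂ z≤w ∷ cmp) = there (maximal w (z≤w , w≤y) (inj₂ z≤w ∷ cmp))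
      extended w (x≤w , _) (_ ∷ inj₁ w≤z ∷ _) with w Fin.≟ x | w Fin.≟ z
      ... | yes w≡x | _       = here w≡x
      ... | no _    | yes w≡z = there (here w≡z)
      ... | no w≢x  | no w≢z  = ⊥-elim (nothing-between w (x≤w , w≢x ∘ sym) (w≤z , w≢z))

All-∃-map : ∀ {A B : Set} {f : A → B} {ys} → All (λ y → ∃[ x ] y ≡ f x) ys → ∃[ xs ] ys ≡ map f xs
All-∃-map [] = [] , refl
All-∃-map ((x , refl) ∷ ys⊆image) with All-∃-map ys⊆image
... | xs , refl = x ∷ xs , refl

↑ˡ-or-↑ʳ : ∀ m n (p : Fin (m +ℕ n)) → (∃[ i ] p ≡ i ↑ˡ n) ⊎ (∃[ j ] p ≡ m ↑ʳ j)
↑ˡ-or-↑ʳ m n p with splitAt m p in eq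
... | inj₁ i = inj₁ (i , sym (splitAt⁻¹-↑ˡ eq))
... | inj₂ j = inj₂ (j , sym (splitAt⁻¹-↑ʳ eq))

-- Q is the union of the image of embed, a down-closed copy of P, and the image of rest;
-- ∑-embed-rest records that the two images are disjoint.
record LowerEmbedding (P Q : FinPoset) : Set where
  field
    embed           : Fin (size P) → Fin (size Q)
    embed-injective : ∀ {x y} → embed x ≡ embed y → x ≡ y
    le-embed        : ∀ x y → le Q (embed x) (embed y) ≡ le P x y
    restSize        : ℕ
    rest            : Fin restSize → Fin (size Q)
    embed-or-rest   : ∀ y → (∃[ x ] y ≡ embed x) ⊎ (∃[ z ] y ≡ rest z)
    ∑-embed-rest    : ∀ F → ∑ (size Q) F ≗ ∑ (size P) (F ∘ embed) +P ∑ restSize (F ∘ rest)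
    rest≰embed      : ∀ z x → le Q (rest z) (embed x) ≡ false

module _ {P Q} (E : LowerEmbedding P Q) where
  open LowerEmbedding E

  embed-downClosed : ∀ w x → _≤P_ Q w (embed x) → ∃[ y ] w ≡ embed y
  embed-downClosed w x w≤ex with embed-or-rest w
  ... | inj₁ w∈image   = w∈image
  ... | inj₂ (z , refl) = ⊥-elim (subst T (rest≰embed z x) w≤ex)

  ≤-embed⁺ : ∀ {x y} → _≤P_ P x y → _≤P_ Q (embed x) (embed y)
  ≤-embed⁺ {x} {y} = subst T (sym (le-embed x y))

  ≤-embed⁻ : ∀ {x y} → _≤P_ Q (embed x) (embed y) → _≤P_ P x y
  ≤-embed⁻ {x} {y} = subst T (le-embed x y)

  IsChain-map⁺ : ∀ {c} → IsChain P c → IsChain Q (map embed c)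
  IsChain-map⁺ = Linked.map⁺ ∘ Linked.map (λ (x≤y , x≢y) → ≤-embed⁺ x≤y , x≢y ∘ embed-injective)

  IsChain-map⁻ : ∀ {c} → IsChain Q (map embed c) → IsChain P c
  IsChain-map⁻ = Linked.map (λ (x≤y , x≢y) → ≤-embed⁻ x≤y , x≢y ∘ cong embed) ∘ Linked.map⁻

  IsMaxChainIn-map : ∀ {x y c} → IsMaxChainIn P x y c → IsMaxChainIn Q (embed x) (embed y) (map embed c)
  IsMaxChainIn-map {x} {y} {c} (chain , inside , maximal) =
    IsChain-map⁺ chain ,
    All.map⁺ (All.map (λ (x≤w , w≤y) → ≤-embed⁺ x≤w , ≤-embed⁺ w≤y) inside) ,
    λ w (ex≤w , w≤ey) cmp → maximal′ (embed-downClosed w y w≤ey) ex≤w w≤ey cmp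
    where
    maximal′ : ∀ {w} → ∃[ i ] w ≡ embed i → _≤P_ Q (embed x) w → _≤P_ Q w (embed y) →
               All (Comparable Q w) (map embed c) → w ∈ map embed c
    maximal′ (i , refl) ex≤ei ei≤ey cmp =
      ∈-map⁺ embed (maximal i (≤-embed⁻ ex≤ei , ≤-embed⁻ ei≤ey)
                              (All.map (Sum.map ≤-embed⁻ ≤-embed⁻) (All.map⁻ cmp)))

  rank≡length : ∀ {ρ} → IsRankFunction Q ρ → ∀ {o i c} → IsMaxChainIn P o i (o ∷ c) →
                ρ (embed o) ≡ 0 → ρ (embed i) ≡ length c
  rank≡length {ρ} rank {o} {i} {c} chain@(_ , (_ , o≤i) ∷ _ , _) ρeo≡0 = ℕ.suc-injective (begin
    suc (ρ (embed i))                         ≡⟨ rank (embed o) (embed i) (map embed (o ∷ c)) (≤-embed⁺ o≤i) (IsMaxChainIn-map chain) ⟩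
    ρ (embed o) +ℕ length (map embed (o ∷ c)) ≡⟨ cong₂ _+ℕ_ ρeo≡0 (length-map embed (o ∷ c)) ⟩
    suc (length c)                            ∎)
    where open ≡-Reasoning

  isPoset-pullback : IsPoset Q → IsPoset P
  isPoset-pullback po = record
    { isPreorder = record
      { isEquivalence = isEquivalence
      ; reflexive     = λ { refl → ≤-embed⁻ ≤.refl }
      ; trans         = λ x≤y y≤z → ≤-embed⁻ (≤.trans (≤-embed⁺ x≤y) (≤-embed⁺ y≤z))
      }
    ; antisym = λ x≤y y≤x → embed-injective (≤.antisym (≤-embed⁺ x≤y) (≤-embed⁺ y≤x))
    }
    where module ≤ = IsPartialOrder po

  minimum-in-image : ∀ {ρ} → IsLowerEulerian Q ρ → Fin (size P) →
                     ∃[ o ] ((∀ j → _≤P_ P o j) × ρ (embed o) ≡ 0)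
  minimum-in-image (_ , _ , _ , ẑ , ẑ≤ , ρẑ≡0) i with embed-downClosed ẑ i (ẑ≤ (embed i))
  ... | o , refl = o , (λ j → ≤-embed⁻ (ẑ≤ (embed j))) , ρẑ≡0

  chain-in-image-≤ : ∀ {r} → IsRk P r → ∀ {c} → All (λ y → ∃[ x ] y ≡ embed x) c → IsChain Q c →
                     + length c ℤ.- 1ℤ ℤ.≤ r
  chain-in-image-≤ {r} (_ , longest) c⊆image chain with All-∃-map c⊆image
  ... | c′ , refl = subst (λ n → + n ℤ.- 1ℤ ℤ.≤ r) (sym (length-map embed c′)) (longest c′ (IsChain-map⁻ chain))

  rk-mono : ∀ {r r′} → IsRk P r → IsRk Q r′ → r ℤ.≤ r′
  rk-mono {r′ = r′} ((c , chain , refl) , _) (_ , longest) =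
    subst (λ n → + n ℤ.- 1ℤ ℤ.≤ r′) (length-map embed c) (longest (map embed c) (IsChain-map⁺ chain))

-- g and h along lower embeddings

-- gFuel P ρ (suc k) x unfolds to gStep (ρ x) applied to the sum over z < x.
gStep : ℕ → Poly → Poly
gStep r s = if r ≡ᵇ 0 then oneP else negP (truncHalf r s)

gStep-cong : ∀ r {s s′} → s ≗ s′ → gStep r s ≗ gStep r s′
gStep-cong r s≗s′ j with r ≡ᵇ 0
... | true = refl
... | false with (2 ℕ.* j) <ᵇ r
...   | true  = cong -_ (s≗s′ j)
...   | false = refl

-- The summands of t^r h(t⁻¹) in the definition of hPoly
rankTerm : (P : FinPoset) → (Fin (size P) → ℕ) → ℕ → Fin (size P) → Poly
rankTerm P ρ r x = powT1 (r ∸ ρ x) (gLower P ρ x)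

rankSum : (P : FinPoset) → (Fin (size P) → ℕ) → ℕ → Poly
rankSum P ρ r = ∑ (size P) (rankTerm P ρ r)

hPoly≗reflect : ∀ P ρ r → hPoly P ρ (+ r) ≗ reflect r (rankSum P ρ r)
hPoly≗reflect P ρ r i with i ≤ᵇ r
... | true  = cong (λ s → s (r ∸ i)) (sumP-map-allFin _ (rankTerm P ρ r))
... | false = refl

rankSum-suc : ∀ P ρ m → (∀ x → ρ x ℕ.≤ m) → rankSum P ρ (suc m) ≗ mulT1 (rankSum P ρ m)
rankSum-suc P ρ m ρ≤m k = trans (∑-cong _ rankTerm-suc k) (sym (mulT1-∑ _ (rankTerm P ρ m) k))
  where
  rankTerm-suc : ∀ x → rankTerm P ρ (suc m) x ≗ mulT1 (rankTerm P ρ m x)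
  rankTerm-suc x rewrite ℕ.+-∸-assoc 1 (ρ≤m x) = λ _ → refl

rankSum-degree : ∀ P ρ m → (∀ x → ρ x ℕ.≤ m) → DegreeAtMost m (rankSum P ρ m)
rankSum-degree P ρ m ρ≤m = ∑-degree _ λ x →
  degree-mono (ℕ.≤-reflexive (ℕ.m∸n+n≡m (ρ≤m x))) (powT1-degree (m ∸ ρ x) (gFuel-degree P ρ (ρ x) x))

module _ {P Q} (E : LowerEmbedding P Q) where
  open LowerEmbedding E

  ltᵇ-embed : ∀ x y → ltᵇ Q (embed x) (embed y) ≡ ltᵇ P x y
  ltᵇ-embed x y rewrite le-embed x y with x Fin.≟ y
  ... | yes refl = cong (λ d → le P x x ∧ not d) (dec-true (embed x Fin.≟ embed x) refl)
  ... | no x≢y   = cong (λ d → le P x y ∧ not d) (dec-false (embed x Fin.≟ embed y) (x≢y ∘ embed-injective))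

  module _ {ρP : Fin (size P) → ℕ} {ρQ : Fin (size Q) → ℕ} (ρ-embed : ∀ x → ρQ (embed x) ≡ ρP x) where

    gFuel-embed : ∀ k x → gFuel Q ρQ k (embed x) ≗ gFuel P ρP k x
    gFuel-embed zero    x = λ _ → refl
    gFuel-embed (suc k) x j rewrite ρ-embed x = gStep-cong (ρP x) lowerSums j
      where
      termQ : Fin (size Q) → Poly
      termQ z = if ltᵇ Q z (embed x) then powT1 (ρP x ∸ ρQ z) (gFuel Q ρQ k z) else zeroP
      termP : Fin (size P) → Poly
      termP z = if ltᵇ P z x then powT1 (ρP x ∸ ρP z) (gFuel P ρP k z) else zeroP
      termQ-embed : ∀ z → termQ (embed z) ≗ termP z
      termQ-embed z i rewrite ltᵇ-embed z x | ρ-embed z with ltᵇ P z x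
      ... | true  = powT1-cong (ρP x ∸ ρP z) (gFuel-embed k z) i
      ... | false = refl
      termQ-rest : ∀ z → termQ (rest z) ≗ zeroP
      termQ-rest z i rewrite rest≰embed z x = refl
      lowerSums : sumP (map termQ (allFin (size Q))) ≗ sumP (map termP (allFin (size P)))
      lowerSums i = begin
        sumP (map termQ (allFin (size Q))) i                          ≡⟨ cong (λ s → s i) (sumP-map-allFin _ termQ) ⟩
        ∑ (size Q) termQ i                                            ≡⟨ ∑-embed-rest termQ i ⟩
        ∑ (size P) (termQ ∘ embed) i + ∑ restSize (termQ ∘ rest) i    ≡⟨ cong₂ _+_ (∑-cong _ termQ-embed i) (∑-zeroP _ termQ-rest i) ⟩
        ∑ (size P) termP i + 0ℤ                                       ≡⟨ ℤ.+-identityʳ _ ⟩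
        ∑ (size P) termP i                                            ≡⟨ cong (λ s → s i) (sumP-map-allFin _ termP) ⟨
        sumP (map termP (allFin (size P))) i                          ∎
        where open ≡-Reasoning

    gLower-embed : ∀ x → gLower Q ρQ (embed x) ≗ gLower P ρP x
    gLower-embed x rewrite ρ-embed x = gFuel-embed (ρP x) x

    rankTerm-embed : ∀ r x → rankTerm Q ρQ r (embed x) ≗ rankTerm P ρP r x
    rankTerm-embed r x k = trans (cong (λ n → powT1 (r ∸ n) (gLower Q ρQ (embed x)) k) (ρ-embed x))
                                 (powT1-cong (r ∸ ρP x) (gLower-embed x) k)

lowerSet-embedding : ∀ {b a} (le : Fin (b +ℕ a) → Fin (b +ℕ a) → Bool) (leB : Fin b → Fin b → Bool) →
  (∀ i j → le (i ↑ˡ a) (j ↑ˡ a) ≡ leB i j) → IsLowerSetB b a le →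
  LowerEmbedding (mkPoset b leB) (mkPoset (b +ℕ a) le)
lowerSet-embedding {b} {a} le leB le-↑ˡ lower = record
  { embed           = _↑ˡ a
  ; embed-injective = ↑ˡ-injective a _ _
  ; le-embed        = le-↑ˡ
  ; restSize        = a
  ; rest            = b ↑ʳ_
  ; embed-or-rest   = ↑ˡ-or-↑ʳ b a
  ; ∑-embed-rest    = ∑-↑ b a
  ; rest≰embed      = rest≰embed
  }
  where
  ↑ʳ≢↑ˡ : ∀ {u i} → b ↑ʳ u ≢ i ↑ˡ a
  ↑ʳ≢↑ˡ {u} {i} eq with trans (sym (splitAt-↑ʳ b a u)) (trans (cong (splitAt b) eq) (splitAt-↑ˡ b i a))
  ... | ()
  rest≰embed : ∀ u j → le (b ↑ʳ u) (j ↑ˡ a) ≡ false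
  rest≰embed u j with le (b ↑ʳ u) (j ↑ˡ a) in eq
  ... | false = refl
  ... | true  = ⊥-elim (↑ʳ≢↑ˡ (proj₂ (lower (b ↑ʳ u) j (subst T (sym eq) _))))

-- The agglutination

module Agglutinated (b a₁ a₂ : ℕ)
  (le₁ : Fin (b +ℕ a₁) → Fin (b +ℕ a₁) → Bool)
  (le₂ : Fin (b +ℕ a₂) → Fin (b +ℕ a₂) → Bool)
  (agree : ∀ (i j : Fin b) → le₁ (i ↑ˡ a₁) (j ↑ˡ a₁) ≡ le₂ (i ↑ˡ a₂) (j ↑ˡ a₂))
  (lower₁ : IsLowerSetB b a₁ le₁) (lower₂ : IsLowerSetB b a₂ le₂) where

  open Agglutination b a₁ a₂ le₁ le₂

  Γ₁ Γ₂ ΓB : FinPoset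
  Γ₁ = mkPoset (b +ℕ a₁) le₁
  Γ₂ = mkPoset (b +ℕ a₂) le₂
  ΓB = subB b a₁ le₁

  ΓB↪Γ₁ : LowerEmbedding ΓB Γ₁
  ΓB↪Γ₁ = lowerSet-embedding le₁ _ (λ _ _ → refl) lower₁

  ΓB↪Γ₂ : LowerEmbedding ΓB Γ₂
  ΓB↪Γ₂ = lowerSet-embedding le₂ _ (λ i j → sym (agree i j)) lower₂

  Part : Set
  Part = Fin b ⊎ (Fin a₁ ⊎ Fin a₂)

  fromSide : Part → Fin (size agg)
  fromSide = join b (a₁ +ℕ a₂) ∘ Sum.map₂ (join a₁ a₂)

  side-fromSide : ∀ s → side (fromSide s) ≡ s
  side-fromSide (inj₁ i) rewrite splitAt-↑ˡ b i (a₁ +ℕ a₂) = refl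
  side-fromSide (inj₂ (inj₁ u)) rewrite splitAt-↑ʳ b (a₁ +ℕ a₂) (u ↑ˡ a₂) | splitAt-↑ˡ a₁ u a₂ = refl
  side-fromSide (inj₂ (inj₂ v)) rewrite splitAt-↑ʳ b (a₁ +ℕ a₂) (a₁ ↑ʳ v) | splitAt-↑ʳ a₁ a₂ v = refl

  fromSide-surjective : ∀ x → ∃[ s ] x ≡ fromSide s
  fromSide-surjective x with ↑ˡ-or-↑ʳ b (a₁ +ℕ a₂) x
  ... | inj₁ (i , refl) = inj₁ i , refl
  ... | inj₂ (k , refl) with ↑ˡ-or-↑ʳ a₁ a₂ k
  ...   | inj₁ (u , refl) = inj₂ (inj₁ u) , refl
  ...   | inj₂ (v , refl) = inj₂ (inj₂ v) , refl

  ∑-fromSide : ∀ F → ∑ (size agg) F ≗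
    ∑ b (F ∘ fromSide ∘ inj₁) +P (∑ a₁ (F ∘ fromSide ∘ inj₂ ∘ inj₁) +P ∑ a₂ (F ∘ fromSide ∘ inj₂ ∘ inj₂))
  ∑-fromSide F k = trans (∑-↑ b (a₁ +ℕ a₂) F k) (cong (λ w → ∑ b (F ∘ (_↑ˡ (a₁ +ℕ a₂))) k + w) (∑-↑ a₁ a₂ (F ∘ (b ↑ʳ_)) k))

  lePart : Part → Part → Bool
  lePart (inj₁ i)        (inj₁ j)         = le₁ (i ↑ˡ a₁) (j ↑ˡ a₁)
  lePart (inj₁ i)        (inj₂ (inj₁ u))  = le₁ (i ↑ˡ a₁) (b ↑ʳ u)
  lePart (inj₁ i)        (inj₂ (inj₂ v))  = le₂ (i ↑ˡ a₂) (b ↑ʳ v)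
  lePart (inj₂ (inj₁ u)) (inj₁ j)         = le₁ (b ↑ʳ u) (j ↑ˡ a₁)
  lePart (inj₂ (inj₁ u)) (inj₂ (inj₁ u′)) = le₁ (b ↑ʳ u) (b ↑ʳ u′)
  lePart (inj₂ (inj₁ _)) (inj₂ (inj₂ _))  = false
  lePart (inj₂ (inj₂ v)) (inj₁ j)         = le₂ (b ↑ʳ v) (j ↑ˡ a₂)
  lePart (inj₂ (inj₂ _)) (inj₂ (inj₁ _))  = false
  lePart (inj₂ (inj₂ v)) (inj₂ (inj₂ v′)) = le₂ (b ↑ʳ v) (b ↑ʳ v′)

  -- leAgg inspects side x and side y again in its second with, hence the repeated rewrites.
  leAgg-side : ∀ {x y} s t → side x ≡ s → side y ≡ t → leAgg x y ≡ lePart s t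
  leAgg-side (inj₁ _)        (inj₁ _)        ex ey rewrite ex | ey = refl
  leAgg-side (inj₁ _)        (inj₂ (inj₁ _)) ex ey rewrite ex | ey = refl
  leAgg-side (inj₁ _)        (inj₂ (inj₂ _)) ex ey rewrite ex | ey | ex | ey = refl
  leAgg-side (inj₂ (inj₁ _)) (inj₁ _)        ex ey rewrite ex | ey = refl
  leAgg-side (inj₂ (inj₁ _)) (inj₂ (inj₁ _)) ex ey rewrite ex | ey = refl
  leAgg-side (inj₂ (inj₁ _)) (inj₂ (inj₂ _)) ex ey rewrite ex | ey | ex = refl
  leAgg-side (inj₂ (inj₂ _)) (inj₁ _)        ex ey rewrite ex | ey | ex = refl
  leAgg-side (inj₂ (inj₂ _)) (inj₂ (inj₁ _)) ex ey rewrite ex | ey | ex = refl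
  leAgg-side (inj₂ (inj₂ _)) (inj₂ (inj₂ _)) ex ey rewrite ex | ey | ex = refl

  leAgg-fromSide : ∀ s t → leAgg (fromSide s) (fromSide t) ≡ lePart s t
  leAgg-fromSide s t = leAgg-side s t (side-fromSide s) (side-fromSide t)


  embed₁ : Fin (b +ℕ a₁) → Fin (size agg)
  embed₁ = fromSide ∘ Sum.map₂ inj₁ ∘ splitAt b

  embed₂ : Fin (b +ℕ a₂) → Fin (size agg)
  embed₂ = fromSide ∘ Sum.map₂ inj₂ ∘ splitAt b

  rest₁ : Fin a₂ → Fin (size agg)
  rest₁ v = fromSide (inj₂ (inj₂ v))

  rest₂ : Fin a₁ → Fin (size agg)
  rest₂ u = fromSide (inj₂ (inj₁ u))

  embed₁-join : ∀ s → embed₁ (join b a₁ s) ≡ fromSide (Sum.map₂ inj₁ s)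
  embed₁-join s = cong (fromSide ∘ Sum.map₂ inj₁) (splitAt-join b a₁ s)

  embed₂-join : ∀ s → embed₂ (join b a₂ s) ≡ fromSide (Sum.map₂ inj₂ s)
  embed₂-join s = cong (fromSide ∘ Sum.map₂ inj₂) (splitAt-join b a₂ s)

  in₁-side-embed₁ : ∀ p → in₁ (side (embed₁ p)) ≡ just p
  in₁-side-embed₁ p = begin
    in₁ (side (embed₁ p))             ≡⟨ cong in₁ (side-fromSide _) ⟩
    in₁ (Sum.map₂ inj₁ (splitAt b p)) ≡⟨ in₁-map₂ (splitAt b p) ⟩
    just (join b a₁ (splitAt b p))    ≡⟨ cong just (join-splitAt b a₁ p) ⟩
    just p                            ∎
    where
    open ≡-Reasoning
    in₁-map₂ : ∀ s → in₁ (Sum.map₂ inj₁ s) ≡ just (join b a₁ s)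
    in₁-map₂ (inj₁ _) = refl
    in₁-map₂ (inj₂ _) = refl

  in₂-side-embed₂ : ∀ p → in₂ (side (embed₂ p)) ≡ just p
  in₂-side-embed₂ p = begin
    in₂ (side (embed₂ p))             ≡⟨ cong in₂ (side-fromSide _) ⟩
    in₂ (Sum.map₂ inj₂ (splitAt b p)) ≡⟨ in₂-map₂ (splitAt b p) ⟩
    just (join b a₂ (splitAt b p))    ≡⟨ cong just (join-splitAt b a₂ p) ⟩
    just p                            ∎
    where
    open ≡-Reasoning
    in₂-map₂ : ∀ s → in₂ (Sum.map₂ inj₂ s) ≡ just (join b a₂ s)
    in₂-map₂ (inj₁ _) = refl
    in₂-map₂ (inj₂ _) = refl

  le-embed₁ : ∀ p q → leAgg (embed₁ p) (embed₁ q) ≡ le₁ p q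
  le-embed₁ p q = trans (leAgg-fromSide (Sum.map₂ inj₁ (splitAt b p)) (Sum.map₂ inj₁ (splitAt b q)))
    (trans (lePart-map₂ (splitAt b p) (splitAt b q)) (cong₂ le₁ (join-splitAt b a₁ p) (join-splitAt b a₁ q)))
    where
    lePart-map₂ : ∀ s t → lePart (Sum.map₂ inj₁ s) (Sum.map₂ inj₁ t) ≡ le₁ (join b a₁ s) (join b a₁ t)
    lePart-map₂ (inj₁ _) (inj₁ _) = refl
    lePart-map₂ (inj₁ _) (inj₂ _) = refl
    lePart-map₂ (inj₂ _) (inj₁ _) = refl
    lePart-map₂ (inj₂ _) (inj₂ _) = refl

  le-embed₂ : ∀ p q → leAgg (embed₂ p) (embed₂ q) ≡ le₂ p q
  le-embed₂ p q = trans (leAgg-fromSide (Sum.map₂ inj₂ (splitAt b p)) (Sum.map₂ inj₂ (splitAt b q)))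
    (trans (lePart-map₂ (splitAt b p) (splitAt b q)) (cong₂ le₂ (join-splitAt b a₂ p) (join-splitAt b a₂ q)))
    where
    lePart-map₂ : ∀ s t → lePart (Sum.map₂ inj₂ s) (Sum.map₂ inj₂ t) ≡ le₂ (join b a₂ s) (join b a₂ t)
    lePart-map₂ (inj₁ i) (inj₁ j) = agree i j
    lePart-map₂ (inj₁ _) (inj₂ _) = refl
    lePart-map₂ (inj₂ _) (inj₁ _) = refl
    lePart-map₂ (inj₂ _) (inj₂ _) = refl

  rest₁≰embed₁ : ∀ v p → leAgg (rest₁ v) (embed₁ p) ≡ false
  rest₁≰embed₁ v p = trans (leAgg-fromSide (inj₂ (inj₂ v)) (Sum.map₂ inj₁ (splitAt b p))) (lePart-map₂ (splitAt b p))
    where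
    lePart-map₂ : ∀ s → lePart (inj₂ (inj₂ v)) (Sum.map₂ inj₁ s) ≡ false
    lePart-map₂ (inj₁ j) = LowerEmbedding.rest≰embed ΓB↪Γ₂ v j
    lePart-map₂ (inj₂ _) = refl

  rest₂≰embed₂ : ∀ u p → leAgg (rest₂ u) (embed₂ p) ≡ false
  rest₂≰embed₂ u p = trans (leAgg-fromSide (inj₂ (inj₁ u)) (Sum.map₂ inj₂ (splitAt b p))) (lePart-map₂ (splitAt b p))
    where
    lePart-map₂ : ∀ s → lePart (inj₂ (inj₁ u)) (Sum.map₂ inj₂ s) ≡ false
    lePart-map₂ (inj₁ j) = LowerEmbedding.rest≰embed ΓB↪Γ₁ u j
    lePart-map₂ (inj₂ _) = refl

  embed₁-or-rest₁ : ∀ x → (∃[ p ] x ≡ embed₁ p) ⊎ (∃[ v ] x ≡ rest₁ v)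
  embed₁-or-rest₁ x with fromSide-surjective x
  ... | inj₁ i , refl        = inj₁ (i ↑ˡ a₁ , sym (embed₁-join (inj₁ i)))
  ... | inj₂ (inj₁ u) , refl = inj₁ (b ↑ʳ u , sym (embed₁-join (inj₂ u)))
  ... | inj₂ (inj₂ v) , refl = inj₂ (v , refl)

  embed₂-or-rest₂ : ∀ x → (∃[ p ] x ≡ embed₂ p) ⊎ (∃[ u ] x ≡ rest₂ u)
  embed₂-or-rest₂ x with fromSide-surjective x
  ... | inj₁ i , refl        = inj₁ (i ↑ˡ a₂ , sym (embed₂-join (inj₁ i)))
  ... | inj₂ (inj₁ u) , refl = inj₂ (u , refl)
  ... | inj₂ (inj₂ v) , refl = inj₁ (b ↑ʳ v , sym (embed₂-join (inj₂ v)))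

  ∑-embed₁ : ∀ F → ∑ (b +ℕ a₁) (F ∘ embed₁) ≗ ∑ b (F ∘ fromSide ∘ inj₁) +P ∑ a₁ (F ∘ fromSide ∘ inj₂ ∘ inj₁)
  ∑-embed₁ F k = trans (∑-↑ b a₁ (F ∘ embed₁) k) (cong₂ _+_
    (∑-cong b (λ i j → cong (λ x → F x j) (embed₁-join (inj₁ i))) k)
    (∑-cong a₁ (λ u j → cong (λ x → F x j) (embed₁-join (inj₂ u))) k))

  ∑-embed₂ : ∀ F → ∑ (b +ℕ a₂) (F ∘ embed₂) ≗ ∑ b (F ∘ fromSide ∘ inj₁) +P ∑ a₂ (F ∘ fromSide ∘ inj₂ ∘ inj₂)
  ∑-embed₂ F k = trans (∑-↑ b a₂ (F ∘ embed₂) k) (cong₂ _+_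
    (∑-cong b (λ i j → cong (λ x → F x j) (embed₂-join (inj₁ i))) k)
    (∑-cong a₂ (λ v j → cong (λ x → F x j) (embed₂-join (inj₂ v))) k))

  ∑-embed-rest₁ : ∀ F → ∑ (size agg) F ≗ ∑ (b +ℕ a₁) (F ∘ embed₁) +P ∑ a₂ (F ∘ rest₁)
  ∑-embed-rest₁ F k = begin
    ∑ (size agg) F k                                                ≡⟨ ∑-fromSide F k ⟩
    B + (X₁ + ∑ a₂ (F ∘ rest₁) k)                                   ≡⟨ ℤ.+-assoc B X₁ _ ⟨
    B + X₁ + ∑ a₂ (F ∘ rest₁) k                                     ≡⟨ cong (_+ ∑ a₂ (F ∘ rest₁) k) (∑-embed₁ F k) ⟨
    ∑ (b +ℕ a₁) (F ∘ embed₁) k + ∑ a₂ (F ∘ rest₁) k                ∎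
    where
    open ≡-Reasoning
    B = ∑ b (F ∘ fromSide ∘ inj₁) k
    X₁ = ∑ a₁ (F ∘ fromSide ∘ inj₂ ∘ inj₁) k

  ∑-embed-rest₂ : ∀ F → ∑ (size agg) F ≗ ∑ (b +ℕ a₂) (F ∘ embed₂) +P ∑ a₁ (F ∘ rest₂)
  ∑-embed-rest₂ F k = begin
    ∑ (size agg) F k                                                ≡⟨ ∑-fromSide F k ⟩
    B + (∑ a₁ (F ∘ rest₂) k + X₂)                                   ≡⟨ +-interchange B _ X₂ ⟩
    B + X₂ + ∑ a₁ (F ∘ rest₂) k                                     ≡⟨ cong (_+ ∑ a₁ (F ∘ rest₂) k) (∑-embed₂ F k) ⟨
    ∑ (b +ℕ a₂) (F ∘ embed₂) k + ∑ a₁ (F ∘ rest₂) k                ∎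
    where
    open ≡-Reasoning
    B = ∑ b (F ∘ fromSide ∘ inj₁) k
    X₂ = ∑ a₂ (F ∘ fromSide ∘ inj₂ ∘ inj₂) k
    +-interchange : ∀ x y z → x + (y + z) ≡ x + z + y
    +-interchange = solve-∀

  Γ₁↪agg : LowerEmbedding Γ₁ agg
  Γ₁↪agg = record
    { embed           = embed₁
    ; embed-injective = λ eq → just-injective (trans (sym (in₁-side-embed₁ _)) (trans (cong (in₁ ∘ side) eq) (in₁-side-embed₁ _)))
    ; le-embed        = le-embed₁
    ; restSize        = a₂
    ; rest            = rest₁
    ; embed-or-rest   = embed₁-or-rest₁
    ; ∑-embed-rest    = ∑-embed-rest₁
    ; rest≰embed      = rest₁≰embed₁
    }

  Γ₂↪agg : LowerEmbedding Γ₂ agg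
  Γ₂↪agg = record
    { embed           = embed₂
    ; embed-injective = λ eq → just-injective (trans (sym (in₂-side-embed₂ _)) (trans (cong (in₂ ∘ side) eq) (in₂-side-embed₂ _)))
    ; le-embed        = le-embed₂
    ; restSize        = a₁
    ; rest            = rest₂
    ; embed-or-rest   = embed₂-or-rest₂
    ; ∑-embed-rest    = ∑-embed-rest₂
    ; rest≰embed      = rest₂≰embed₂
    }

  chain-one-sided : ∀ {c} → IsChain agg c →
    All (λ x → ∃[ p ] x ≡ embed₁ p) c ⊎ All (λ x → ∃[ p ] x ≡ embed₂ p) c
  chain-one-sided {[]} _ = inj₁ []
  chain-one-sided {x ∷ []} _ with embed₁-or-rest₁ x
  ... | inj₁ x∈₁        = inj₁ (x∈₁ ∷ [])
  ... | inj₂ (v , refl) = inj₂ ((b ↑ʳ v , sym (embed₂-join (inj₂ v))) ∷ [])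
  chain-one-sided {x ∷ _ ∷ _} (x<y ∷ chain) with chain-one-sided chain
  ... | inj₁ ys@((q , refl) ∷ _) = inj₁ (embed-downClosed Γ₁↪agg x q (proj₁ x<y) ∷ ys)
  ... | inj₂ ys@((q , refl) ∷ _) = inj₂ (embed-downClosed Γ₂↪agg x q (proj₁ x<y) ∷ ys)

  rk-agg : ∀ {r rA} → IsRk Γ₁ r → IsRk Γ₂ r → IsRk agg rA → rA ≡ r
  rk-agg rk₁ rk₂ rkA@((c , chain , refl) , _) = ℤ.≤-antisym longest≤r (rk-mono Γ₁↪agg rk₁ rkA)
    where
    longest≤r : + length c ℤ.- 1ℤ ℤ.≤ _
    longest≤r with chain-one-sided chain
    ... | inj₁ c⊆₁ = chain-in-image-≤ Γ₁↪agg rk₁ c⊆₁ chain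
    ... | inj₂ c⊆₂ = chain-in-image-≤ Γ₂↪agg rk₂ c⊆₂ chain

module LowerEulerianAgglutination (b a₁ a₂ : ℕ)
  (le₁ : Fin (b +ℕ a₁) → Fin (b +ℕ a₁) → Bool)
  (le₂ : Fin (b +ℕ a₂) → Fin (b +ℕ a₂) → Bool)
  (ρ₁ : Fin (b +ℕ a₁) → ℕ) (ρ₂ : Fin (b +ℕ a₂) → ℕ)
  (lowerEulerian₁ : IsLowerEulerian (mkPoset (b +ℕ a₁) le₁) ρ₁)
  (lowerEulerian₂ : IsLowerEulerian (mkPoset (b +ℕ a₂) le₂) ρ₂)
  (agree : ∀ (i j : Fin b) → le₁ (i ↑ˡ a₁) (j ↑ˡ a₁) ≡ le₂ (i ↑ˡ a₂) (j ↑ˡ a₂))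
  (lower₁ : IsLowerSetB b a₁ le₁) (lower₂ : IsLowerSetB b a₂ le₂) where

  open Agglutination b a₁ a₂ le₁ le₂ using (agg; ρAgg)
  open Agglutinated b a₁ a₂ le₁ le₂ agree lower₁ lower₂

  ρB : Fin b → ℕ
  ρB j = ρ₁ (j ↑ˡ a₁)

  ρA : Fin (size agg) → ℕ
  ρA = ρAgg ρ₁ ρ₂

  private
    module ≤B = IsPartialOrder (isPoset-pullback ΓB↪Γ₁ (proj₁ lowerEulerian₁))
    rank₁ = proj₁ (proj₂ lowerEulerian₁)
    rank₂ = proj₁ (proj₂ lowerEulerian₂)

  chain-from-minimum : ∀ i → ∃[ o ] ∃[ c ]
    (IsMaxChainIn ΓB o i (o ∷ c) × ρ₁ (o ↑ˡ a₁) ≡ 0 × ρ₂ (o ↑ˡ a₂) ≡ 0)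
  chain-from-minimum i
    with minimum-in-image ΓB↪Γ₁ lowerEulerian₁ i | minimum-in-image ΓB↪Γ₂ lowerEulerian₂ i
  ... | o , o≤ , ρ₁o≡0 | o′ , o′≤ , ρ₂o′≡0 =
    o , c , chain , ρ₁o≡0 , subst (λ w → ρ₂ (w ↑ˡ a₂) ≡ 0) (≤B.antisym (o′≤ o) (o≤ o′)) ρ₂o′≡0
    where
    open MaximalChains ΓB (isPoset-pullback ΓB↪Γ₁ (proj₁ lowerEulerian₁))
    c = proj₁ (maximalChain (o≤ i))
    chain = proj₂ (maximalChain (o≤ i))

  ρ₁≡ρ₂ : ∀ i → ρ₁ (i ↑ˡ a₁) ≡ ρ₂ (i ↑ˡ a₂)
  ρ₁≡ρ₂ i with chain-from-minimum i
  ... | o , c , chain , ρ₁o≡0 , ρ₂o≡0 =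
    trans (rank≡length ΓB↪Γ₁ rank₁ chain ρ₁o≡0) (sym (rank≡length ΓB↪Γ₂ rank₂ chain ρ₂o≡0))

  ρB≤rk : ∀ {rB} → IsRk ΓB rB → ∀ i → + ρB i ℤ.≤ rB
  ρB≤rk {rB} (_ , longest) i with chain-from-minimum i
  ... | o , c , chain , ρ₁o≡0 , _ =
    subst (λ n → + n ℤ.≤ rB) (sym (rank≡length ΓB↪Γ₁ rank₁ chain ρ₁o≡0)) (longest (o ∷ c) (proj₁ chain))

  ρ-embed₁ : ∀ p → ρA (embed₁ p) ≡ ρ₁ p
  ρ-embed₁ p = trans (ρ-fromSide (splitAt b p)) (cong ρ₁ (join-splitAt b a₁ p))
    where
    ρ-fromSide : ∀ s → ρA (fromSide (Sum.map₂ inj₁ s)) ≡ ρ₁ (join b a₁ s)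
    ρ-fromSide (inj₁ i) rewrite side-fromSide (inj₁ i) = refl
    ρ-fromSide (inj₂ u) rewrite side-fromSide (inj₂ (inj₁ u)) = refl

  ρ-embed₂ : ∀ p → ρA (embed₂ p) ≡ ρ₂ p
  ρ-embed₂ p = trans (ρ-fromSide (splitAt b p)) (cong ρ₂ (join-splitAt b a₂ p))
    where
    ρ-fromSide : ∀ s → ρA (fromSide (Sum.map₂ inj₂ s)) ≡ ρ₂ (join b a₂ s)
    ρ-fromSide (inj₁ i) rewrite side-fromSide (inj₁ i) = ρ₁≡ρ₂ i
    ρ-fromSide (inj₂ v) rewrite side-fromSide (inj₂ (inj₂ v)) = refl

  rankSum-agg : ∀ r → rankSum agg ρA r ≗ rankSum Γ₁ ρ₁ r +P (rankSum Γ₂ ρ₂ r +P negP (rankSum ΓB ρB r))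
  rankSum-agg r k = begin
    rankSum agg ρA r k                                          ≡⟨ LowerEmbedding.∑-embed-rest Γ₁↪agg (rankTerm agg ρA r) k ⟩
    ∑ (b +ℕ a₁) (rankTerm agg ρA r ∘ embed₁) k + X              ≡⟨ cong (_+ X) (∑-cong _ (rankTerm-embed Γ₁↪agg {ρ₁} {ρA} ρ-embed₁ r) k) ⟩
    rankSum Γ₁ ρ₁ r k + X                                       ≡⟨ +-cancel (rankSum Γ₁ ρ₁ r k) (rankSum ΓB ρB r k) X ⟩
    rankSum Γ₁ ρ₁ r k + (rankSum ΓB ρB r k + X + - rankSum ΓB ρB r k) ≡⟨ cong (λ s₂ → rankSum Γ₁ ρ₁ r k + (s₂ + - rankSum ΓB ρB r k)) Γ₂-split ⟨
    rankSum Γ₁ ρ₁ r k + (rankSum Γ₂ ρ₂ r k + - rankSum ΓB ρB r k) ∎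
    where
    open ≡-Reasoning
    X = ∑ a₂ (rankTerm agg ρA r ∘ rest₁) k
    +-cancel : ∀ x y z → x + z ≡ x + (y + z + - y)
    +-cancel = solve-∀
    rest-part : ∀ v → rankTerm Γ₂ ρ₂ r (b ↑ʳ v) ≗ rankTerm agg ρA r (rest₁ v)
    rest-part v j = trans (sym (rankTerm-embed Γ₂↪agg {ρ₂} {ρA} ρ-embed₂ r (b ↑ʳ v) j))
                          (cong (λ x → rankTerm agg ρA r x j) (embed₂-join (inj₂ v)))
    Γ₂-split : rankSum Γ₂ ρ₂ r k ≡ rankSum ΓB ρB r k + X
    Γ₂-split = trans (∑-↑ b a₂ (rankTerm Γ₂ ρ₂ r) k)
      (cong₂ _+_ (∑-cong b (rankTerm-embed ΓB↪Γ₂ {ρB} {ρ₂} (sym ∘ ρ₁≡ρ₂) r) k) (∑-cong a₂ rest-part k))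

  hPoly-agg : ∀ r {hB} → reflect r (rankSum ΓB ρB r) ≗ negP hB →
              ∀ i → hPoly agg ρA (+ r) i ≡ hPoly Γ₁ ρ₁ (+ r) i + hPoly Γ₂ ρ₂ (+ r) i + hB i
  hPoly-agg r {hB} boundary i = begin
    hPoly agg ρA (+ r) i                       ≡⟨ hPoly≗reflect agg ρA r i ⟩
    reflect r (rankSum agg ρA r) i             ≡⟨ reflect-cong r (rankSum-agg r) i ⟩
    reflect r (S₁ +P (S₂ +P negP SB)) i        ≡⟨ reflect-+P r S₁ (S₂ +P negP SB) i ⟩
    h₁ + reflect r (S₂ +P negP SB) i           ≡⟨ cong (λ w → h₁ + w) (reflect-+P r S₂ (negP SB) i) ⟩
    h₁ + (h₂ + reflect r (negP SB) i)          ≡⟨ cong (λ w → h₁ + (h₂ + w)) (trans (reflect-negP r SB i) (cong -_ (boundary i))) ⟩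
    h₁ + (h₂ + - - hB i)                       ≡⟨ shuffle h₁ h₂ (hB i) ⟩
    h₁ + h₂ + hB i                             ≡⟨ cong₂ (λ x y → x + y + hB i) (hPoly≗reflect Γ₁ ρ₁ r i) (hPoly≗reflect Γ₂ ρ₂ r i) ⟨
    hPoly Γ₁ ρ₁ (+ r) i + hPoly Γ₂ ρ₂ (+ r) i + hB i ∎
    where
    open ≡-Reasoning
    S₁ = rankSum Γ₁ ρ₁ r
    S₂ = rankSum Γ₂ ρ₂ r
    SB = rankSum ΓB ρB r
    h₁ = reflect r S₁ i
    h₂ = reflect r S₂ i
    shuffle : ∀ x y z → x + (y + - - z) ≡ x + y + z
    shuffle = solve-∀

  hPoly-agglutination : ∀ {rB} → IsRk ΓB rB → ∀ i →
    hPoly agg ρA (rB + 1ℤ) i ≡ hPoly Γ₁ ρ₁ (rB + 1ℤ) i + hPoly Γ₂ ρ₂ (rB + 1ℤ) i + mulT1 (hPoly ΓB ρB rB) i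
  hPoly-agglutination {+ m} rkB rewrite ℕ.+-comm m 1 = hPoly-agg (suc m) boundary
    where
    ρB≤m : ∀ i → ρB i ℕ.≤ m
    ρB≤m i = ℤ.drop‿+≤+ (ρB≤rk rkB i)
    boundary : reflect (suc m) (rankSum ΓB ρB (suc m)) ≗ negP (mulT1 (hPoly ΓB ρB (+ m)))
    boundary i = begin
      reflect (suc m) (rankSum ΓB ρB (suc m)) i         ≡⟨ reflect-cong (suc m) (rankSum-suc ΓB ρB m ρB≤m) i ⟩
      reflect (suc m) (mulT1 (rankSum ΓB ρB m)) i       ≡⟨ reflect-mulT1 m (rankSum-degree ΓB ρB m ρB≤m) i ⟩
      - mulT1 (reflect m (rankSum ΓB ρB m)) i           ≡⟨ cong -_ (mulT1-cong (hPoly≗reflect ΓB ρB m) i) ⟨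
      - mulT1 (hPoly ΓB ρB (+ m)) i                     ∎
      where open ≡-Reasoning
  hPoly-agglutination { -[1+ 0 ]} rkB = hPoly-agg 0 boundary
    where
    no-boundary : Fin b → ⊥
    no-boundary j with ρB≤rk rkB j
    ... | ()
    boundary : reflect 0 (rankSum ΓB ρB 0) ≗ negP (mulT1 (hPoly ΓB ρB -[1+ 0 ]))
    boundary zero    = ∑-zeroP b (⊥-elim ∘ no-boundary) 0
    boundary (suc _) = refl
  hPoly-agglutination { -[1+ suc _ ]} (_ , longest) with longest [] []
  ... | -≤- ()

≡-1⇒≡+1 : ∀ r {s} → s ≡ r - 1ℤ → r ≡ s + 1ℤ
≡-1⇒≡+1 r refl = sym (-1+1 r)
  where
  -1+1 : ∀ r → r - 1ℤ + 1ℤ ≡ r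
  -1+1 = solve-∀

lemma3p3 : (b a₁ a₂ : ℕ)
    (le₁ : Fin (b +ℕ a₁) → Fin (b +ℕ a₁) → Bool)
    (le₂ : Fin (b +ℕ a₂) → Fin (b +ℕ a₂) → Bool)
    (ρ₁ : Fin (b +ℕ a₁) → ℕ) (ρ₂ : Fin (b +ℕ a₂) → ℕ) →
    IsLowerEulerian (mkPoset (b +ℕ a₁) le₁) ρ₁ →
    IsLowerEulerian (mkPoset (b +ℕ a₂) le₂) ρ₂ →
    (∀ (i j : Fin b) → le₁ (i ↑ˡ a₁) (j ↑ˡ a₁) ≡ le₂ (i ↑ˡ a₂) (j ↑ˡ a₂)) →
    IsLowerSetB b a₁ le₁ → IsLowerSetB b a₂ le₂ →
    (r₁ r₂ rB rA : ℤ) →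
    IsRk (mkPoset (b +ℕ a₁) le₁) r₁ →
    IsRk (mkPoset (b +ℕ a₂) le₂) r₂ →
    IsRk (subB b a₁ le₁) rB →
    IsRk (Agglutination.agg b a₁ a₂ le₁ le₂) rA →
    rB ≡ r₁ - 1ℤ → rB ≡ r₂ - 1ℤ →
    ∀ (i : ℕ) →
      hPoly (Agglutination.agg b a₁ a₂ le₁ le₂) (Agglutination.ρAgg b a₁ a₂ le₁ le₂ ρ₁ ρ₂) rA i
        ≡ hPoly (mkPoset (b +ℕ a₁) le₁) ρ₁ r₁ i
          + hPoly (mkPoset (b +ℕ a₂) le₂) ρ₂ r₂ i
          + mulT1 (hPoly (subB b a₁ le₁) (λ j → ρ₁ (j ↑ˡ a₁)) rB) i
lemma3p3 b a₁ a₂ le₁ le₂ ρ₁ ρ₂ lowerEulerian₁ lowerEulerian₂ agree lower₁ lower₂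
         r₁ r₂ rB rA rk₁ rk₂ rkB rkA rB≡r₁-1 rB≡r₂-1
  with refl ← ≡-1⇒≡+1 r₁ rB≡r₁-1 | refl ← ≡-1⇒≡+1 r₂ rB≡r₂-1
  with refl ← Agglutinated.rk-agg b a₁ a₂ le₁ le₂ agree lower₁ lower₂ rk₁ rk₂ rkA
  = LowerEulerianAgglutination.hPoly-agglutination b a₁ a₂ le₁ le₂ ρ₁ ρ₂
      lowerEulerian₁ lowerEulerian₂ agree lower₁ lower₂ rkB
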